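{- There do not exist integers $b,c,d,e$ with $e\neq 0$ such that the real quaternion $\frac{1}{e}\left(b\sqrt{2}\,\mathbf{i} + c\sqrt{5}\,\mathbf{j} + d\sqrt{10}\,\mathbf{k}\right)$ has norm $1$.
   Context: Real quaternions are $a_1+a_2\mathbf{i}+a_3\mathbf{j}+a_4\mathbf{k}$ with $a_t\in\mathbb{R}$, where $\mathbf{i}^2=\mathbf{j}^2=\mathbf{k}^2=\mathbf{i}\mathbf{j}\mathbf{k}=-1$. The norm is $N(a_1+a_2\mathbf{i}+a_3\mathbf{j}+a_4\mathbf{k}) = a_1^2+a_2^2+a_3^2+a_4^2$. -}

module Defs where

open import Data.Nat using (suc; zero)
open import Data.Integer using (ℤ; +_; -[1+_]; +[1+_]; 0ℤ)
open import Data.Rational using (ℚ; _+_; _*_; 0ℚ; 1ℚ; _/_)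
import Data.Rational as Q
open import Data.Empty using (⊥-elim)
open import Relation.Binary.PropositionalEquality using (_≡_; _≢_; refl)

-- The real subfield K = ℚ(√2, √5) ⊆ ℝ, represented on the ℚ-basis
-- 1, √2, √5, √10 :  x = r + s√2 + t√5 + u√10.
record K : Set where
  constructor mkK
  field
    r s t u : ℚ

infixl 6 _+K_
infixl 7 _*K_
infixr 7 _·H_

_+K_ : K → K → K
mkK a b c d +K mkK a' b' c' d' = mkK (a + a') (b + b') (c + c') (d + d')

-- multiplication using √2√5 = √10, √2√10 = 2√5, √5√10 = 5√2,
-- (√2)² = 2, (√5)² = 5, (√10)² = 10
_*K_ : K → K → K
mkK a b c d *K mkK a' b' c' d' = mkK
  (a * a' + (+ 2 / 1) * (b * b') + (+ 5 / 1) * (c * c') + (+ 10 / 1) * (d * d'))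
  (a * b' + b * a' + (+ 5 / 1) * (c * d' + d * c'))
  (a * c' + c * a' + (+ 2 / 1) * (b * d' + d * b'))
  (a * d' + d * a' + b * c' + c * b')

0K 1K √2 √5 √10 : K
0K  = mkK 0ℚ 0ℚ 0ℚ 0ℚ
1K  = mkK 1ℚ 0ℚ 0ℚ 0ℚ
√2  = mkK 0ℚ 1ℚ 0ℚ 0ℚ
√5  = mkK 0ℚ 0ℚ 1ℚ 0ℚ
√10 = mkK 0ℚ 0ℚ 0ℚ 1ℚ

ℚ→K : ℚ → K
ℚ→K q = mkK q 0ℚ 0ℚ 0ℚ

ℤ→K : ℤ → K
ℤ→K z = ℚ→K (z / 1)

inv : (e : ℤ) → e ≢ 0ℤ → ℚ
inv (+ zero)   p = ⊥-elim (p refl)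
inv +[1+ n ]   _ = + 1 / suc n
inv -[1+ n ]   _ = -[1+ 0 ] / suc n

record Quaternion : Set where
  constructor quat
  field
    a₁ a₂ a₃ a₄ : K

_·H_ : K → Quaternion → Quaternion
x ·H quat a b c d = quat (x *K a) (x *K b) (x *K c) (x *K d)

N : Quaternion → K
N (quat a b c d) = a *K a +K b *K b +K c *K c +K d *K d

module Submission where

-- Clearing the denominator e, the real part of the norm equation becomes
-- 2b² + 5c² + 10d² = e² over ℕ (after taking absolute values). Modulo 5 this
-- gives 2b² ≡ e², equivalently b² + 2e² ≡ 0; as −2 is not a square mod 5, both
-- b and e are divisible by 5. Then c² + 2d² ≡ 0 (mod 5) forces 5 ∣ c, d for the
-- same reason, so (b/5, c/5, d/5, e/5) is again a solution, and infinite descent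
-- leaves only e = 0.

open import Defs
open import Data.Integer using (ℤ; 0ℤ)
open import Data.Product using (Σ-syntax; _×_; _,_)
open import Relation.Binary.PropositionalEquality using (_≡_; _≢_)
open import Relation.Nullary using (¬_)
open import Data.Nat.Induction using (<-wellFounded)
open import Data.Integer.Properties using (∣i∣≡0⇒i≡0)

module _ where
  open import Data.Nat
  open import Data.Nat.Properties using (*-cancelˡ-≡; m<m*n; allUpTo?)
  open import Data.Nat.DivMod using (_%_; %-distribˡ-+; %-distribˡ-*; m%n<n)
  open import Data.Nat.Divisibility
    using (_∣_; _∣?_; divides; divides-refl; m%n≡0⇒n∣m; n∣m⇒m%n≡0; ∣m+n∣m⇒∣n; n∣m*n)
  open import Data.Nat.Tactic.RingSolver using (solve)
  open import Data.List using ([]; _∷_)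
  open import Data.Product using (∃-syntax; map)
  open import Induction.WellFounded using (Acc; acc)
  open import Relation.Binary.PropositionalEquality using (refl; sym; trans; cong; cong₂; module ≡-Reasoning)
  open import Relation.Nullary.Decidable using (from-yes; _→-dec_; _×-dec_)
  open ≡-Reasoning

  form : ℕ → ℕ → ℕ → ℕ
  form x y z = 2 * (x * x) + 5 * (y * y) + 10 * (z * z)

  5∣x²+2y²⇒x≡0×y≡0 : ∀ {x} → x < 5 → ∀ {y} → y < 5 → 5 ∣ x * x + 2 * (y * y) → x ≡ 0 × y ≡ 0
  5∣x²+2y²⇒x≡0×y≡0 = from-yes (allUpTo? (λ x → allUpTo? (λ y →
    (5 ∣? x * x + 2 * (y * y)) →-dec ((x ≟ 0) ×-dec (y ≟ 0))) 5) 5)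

  x²+2y²%n≡[x%n]²+2[y%n]²%n : ∀ x y n .{{_ : NonZero n}} →
    (x * x + 2 * (y * y)) % n ≡ (x % n * (x % n) + 2 * (y % n * (y % n))) % n
  x²+2y²%n≡[x%n]²+2[y%n]²%n x y n = begin
    (x * x + 2 * (y * y)) % n
      ≡⟨ %-distribˡ-+ (x * x) _ n ⟩
    ((x * x) % n + (2 * (y * y)) % n) % n
      ≡⟨ cong (λ t → ((x * x) % n + t) % n) (%-distribˡ-* 2 (y * y) n) ⟩
    ((x * x) % n + (2 % n * ((y * y) % n)) % n) % n
      ≡⟨ cong₂ (λ u v → (u + (2 % n * v) % n) % n) (%-distribˡ-* x x n) (%-distribˡ-* y y n) ⟩
    ((x % n * (x % n)) % n + (2 % n * ((y % n * (y % n)) % n)) % n) % n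
      ≡⟨ cong (λ t → ((x % n * (x % n)) % n + t) % n) (%-distribˡ-* 2 (y % n * (y % n)) n) ⟨
    ((x % n * (x % n)) % n + (2 * (y % n * (y % n))) % n) % n
      ≡⟨ %-distribˡ-+ (x % n * (x % n)) _ n ⟨
    (x % n * (x % n) + 2 * (y % n * (y % n))) % n
      ∎

  5∣x²+2y²⇒5∣x×5∣y : ∀ x y → 5 ∣ x * x + 2 * (y * y) → 5 ∣ x × 5 ∣ y
  5∣x²+2y²⇒5∣x×5∣y x y 5∣x²+2y² = map (m%n≡0⇒n∣m x 5) (m%n≡0⇒n∣m y 5)
    (5∣x²+2y²⇒x≡0×y≡0 (m%n<n x 5) (m%n<n y 5) (m%n≡0⇒n∣m _ 5
      (trans (sym (x²+2y²%n≡[x%n]²+2[y%n]²%n x y 5)) (n∣m⇒m%n≡0 _ 5 5∣x²+2y²))))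

  form≡e²⇒5∣b²+2e² : ∀ b c d e → form b c d ≡ e * e → 5 ∣ b * b + 2 * (e * e)
  form≡e²⇒5∣b²+2e² b c d e eq = divides (b * b + 2 * (c * c) + 4 * (d * d)) (begin
    b * b + 2 * (e * e)                                    ≡⟨ cong (λ t → b * b + 2 * t) eq ⟨
    b * b + 2 * (2 * (b * b) + 5 * (c * c) + 10 * (d * d)) ≡⟨ solve (b ∷ c ∷ d ∷ []) ⟩
    (b * b + 2 * (c * c) + 4 * (d * d)) * 5                ∎)

  form[5b,c,d]≡[5e]²⇒5∣c²+2d² : ∀ b c d e → form (b * 5) c d ≡ (e * 5) * (e * 5) →
                                5 ∣ c * c + 2 * (d * d)
  form[5b,c,d]≡[5e]²⇒5∣c²+2d² b c d e eq =
    ∣m+n∣m⇒∣n (divides (e * e) (*-cancelˡ-≡ _ _ 5 (begin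
      5 * (2 * (b * b) * 5 + (c * c + 2 * (d * d)))      ≡⟨ solve (b ∷ c ∷ d ∷ []) ⟩
      2 * (b * 5 * (b * 5)) + 5 * (c * c) + 10 * (d * d) ≡⟨ eq ⟩
      e * 5 * (e * 5)                                    ≡⟨ solve (e ∷ []) ⟩
      5 * (e * e * 5)                                    ∎)))
      (n∣m*n (2 * (b * b)))

  form[5b,5c,5d]≡[5e]²⇒form≡e² : ∀ b c d e → form (b * 5) (c * 5) (d * 5) ≡ (e * 5) * (e * 5) →
                                 form b c d ≡ e * e
  form[5b,5c,5d]≡[5e]²⇒form≡e² b c d e eq = *-cancelˡ-≡ _ _ 25 (begin
    25 * (2 * (b * b) + 5 * (c * c) + 10 * (d * d))                         ≡⟨ solve (b ∷ c ∷ d ∷ []) ⟩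
    2 * (b * 5 * (b * 5)) + 5 * (c * 5 * (c * 5)) + 10 * (d * 5 * (d * 5)) ≡⟨ eq ⟩
    e * 5 * (e * 5)                                                         ≡⟨ solve (e ∷ []) ⟩
    25 * (e * e)                                                            ∎)

  SquareRepresented : ℕ → Set
  SquareRepresented e = ∃[ b ] ∃[ c ] ∃[ d ] form b c d ≡ e * e

  square-represented-descent : ∀ {e} → SquareRepresented e → ∃[ e′ ] e ≡ e′ * 5 × SquareRepresented e′
  square-represented-descent {e} (b , c , d , eq) =
    divide-b,e (5∣x²+2y²⇒5∣x×5∣y b e (form≡e²⇒5∣b²+2e² b c d e eq)) eq
    where
    divide-c,d : ∀ {b′ e′} → 5 ∣ c × 5 ∣ d → form (b′ * 5) c d ≡ (e′ * 5) * (e′ * 5) → SquareRepresented e′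
    divide-c,d {b′} {e′} (divides-refl c′ , divides-refl d′) eq =
      b′ , c′ , d′ , form[5b,5c,5d]≡[5e]²⇒form≡e² b′ c′ d′ e′ eq

    divide-b,e : ∀ {b e} → 5 ∣ b × 5 ∣ e → form b c d ≡ e * e → ∃[ e′ ] e ≡ e′ * 5 × SquareRepresented e′
    divide-b,e (divides-refl b′ , divides-refl e′) eq =
      e′ , refl , divide-c,d {b′} {e′} (5∣x²+2y²⇒5∣x×5∣y c d (form[5b,c,d]≡[5e]²⇒5∣c²+2d² b′ c d e′ eq)) eq

  square-represented⇒≡0 : ∀ {e} → Acc _<_ e → SquareRepresented e → e ≡ 0
  square-represented⇒≡0 acc-e represented = descend acc-e (square-represented-descent represented)
    where
    descend : ∀ {e} → Acc _<_ e → ∃[ e′ ] e ≡ e′ * 5 × SquareRepresented e′ → e ≡ 0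
    descend _         (zero   , refl , _)            = refl
    descend (acc rec) (suc e′ , refl , represented′)
      with square-represented⇒≡0 (rec (m<m*n (suc e′) 5 (s≤s (s≤s z≤n)))) represented′
    ... | ()

module _ where
  open import Data.Nat as ℕ using (ℕ; zero)
  import Data.Nat.Coprimality as Coprime
  open import Data.Integer as ℤ using (+_; -[1+_]; +[1+_]; ∣_∣)
  open import Data.Integer.Properties as ℤ using (pos-*; pos-+)
  open import Data.Rational using (ℚ; mkℚ; ↥_; _/_; _+_; _*_; 0ℚ; 1ℚ; 1/_)
  open import Data.Rational.Properties using (↥p/↧p≡p; *-inverseʳ; *-identityˡ; *-identityʳ)
  open import Data.Rational.Solver using (module +-*-Solver)
  open import Relation.Binary.PropositionalEquality using (refl; sym; trans; cong; cong₂; module ≡-Reasoning)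
  open import Relation.Nullary using (contradiction)
  open ≡-Reasoning

  -- The normal form of i / 1; ℚ's operations compute on it, unlike on i / 1 itself.
  fromℤ : ℤ → ℚ
  fromℤ i = mkℚ i 0 (Coprime.sym (Coprime.1-coprimeTo ∣ i ∣))

  i/1≡fromℤ : ∀ i → i / 1 ≡ fromℤ i
  i/1≡fromℤ i = ↥p/↧p≡p (fromℤ i)

  /1-injective : ∀ {i j} → i / 1 ≡ j / 1 → i ≡ j
  /1-injective {i} {j} eq = cong ↥_ (trans (sym (i/1≡fromℤ i)) (trans eq (i/1≡fromℤ j)))

  /1-homo-* : ∀ i j → (i ℤ.* j) / 1 ≡ (i / 1) * (j / 1)
  /1-homo-* i j = sym (cong₂ _*_ (i/1≡fromℤ i) (i/1≡fromℤ j))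

  /1-homo-+ : ∀ i j → (i ℤ.+ j) / 1 ≡ (i / 1) + (j / 1)
  /1-homo-+ i j = begin
    (i ℤ.+ j) / 1                 ≡⟨ cong₂ (λ u v → (u ℤ.+ v) / 1) (ℤ.*-identityʳ i) (ℤ.*-identityʳ j) ⟨
    (i ℤ.* + 1 ℤ.+ j ℤ.* + 1) / 1 ≡⟨ cong₂ _+_ (i/1≡fromℤ i) (i/1≡fromℤ j) ⟨
    (i / 1) + (j / 1)             ∎

  ℕ/1-homo-+ : ∀ m n → + (m ℕ.+ n) / 1 ≡ (+ m / 1) + (+ n / 1)
  ℕ/1-homo-+ m n = trans (cong (_/ 1) (pos-+ m n)) (/1-homo-+ (+ m) (+ n))

  i/1*inv≡1 : ∀ e (e≢0 : e ≢ 0ℤ) → (e / 1) * inv e e≢0 ≡ 1ℚ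
  i/1*inv≡1 (+ zero)  e≢0 = contradiction refl e≢0
  i/1*inv≡1 e@(+[1+ _ ]) _ =
    trans (cong₂ _*_ (i/1≡fromℤ e) (↥p/↧p≡p (1/ fromℤ e))) (*-inverseʳ (fromℤ e))
  i/1*inv≡1 e@(-[1+ _ ]) _ =
    trans (cong₂ _*_ (i/1≡fromℤ e) (↥p/↧p≡p (1/ fromℤ e))) (*-inverseʳ (fromℤ e))

  +∣i∣²≡i² : ∀ i → + (∣ i ∣ ℕ.* ∣ i ∣) ≡ i ℤ.* i
  +∣i∣²≡i² (+ n)     = pos-* n n
  +∣i∣²≡i² -[1+ n ] = refl

  i/1²≡+∣i∣²/1 : ∀ i → (i / 1) * (i / 1) ≡ + (∣ i ∣ ℕ.* ∣ i ∣) / 1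
  i/1²≡+∣i∣²/1 i = trans (sym (/1-homo-* i i)) (cong (_/ 1) (sym (+∣i∣²≡i² i)))

  k/1*i/1²≡+k∣i∣²/1 : ∀ k i → (+ k / 1) * ((i / 1) * (i / 1)) ≡ + (k ℕ.* (∣ i ∣ ℕ.* ∣ i ∣)) / 1
  k/1*i/1²≡+k∣i∣²/1 k i = begin
    (+ k / 1) * ((i / 1) * (i / 1))       ≡⟨ cong ((+ k / 1) *_) (i/1²≡+∣i∣²/1 i) ⟩
    (+ k / 1) * (+ (∣ i ∣ ℕ.* ∣ i ∣) / 1) ≡⟨ /1-homo-* (+ k) _ ⟨
    (+ k ℤ.* + (∣ i ∣ ℕ.* ∣ i ∣)) / 1     ≡⟨ cong (_/ 1) (pos-* k _) ⟨
    + (k ℕ.* (∣ i ∣ ℕ.* ∣ i ∣)) / 1       ∎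

  formℚ : ℚ → ℚ → ℚ → ℚ
  formℚ x y z = (+ 2 / 1) * (x * x) + (+ 5 / 1) * (y * y) + (+ 10 / 1) * (z * z)

  formℚ-/1 : ∀ b c d → formℚ (b / 1) (c / 1) (d / 1) ≡ + form (∣ b ∣) (∣ c ∣) (∣ d ∣) / 1
  formℚ-/1 b c d = begin
    formℚ (b / 1) (c / 1) (d / 1)
      ≡⟨ cong₂ _+_ (cong₂ _+_ (k/1*i/1²≡+k∣i∣²/1 2 b) (k/1*i/1²≡+k∣i∣²/1 5 c)) (k/1*i/1²≡+k∣i∣²/1 10 d) ⟩
    (+ x / 1) + (+ y / 1) + (+ z / 1) ≡⟨ cong (_+ (+ z / 1)) (ℕ/1-homo-+ x y) ⟨
    (+ (x ℕ.+ y) / 1) + (+ z / 1)     ≡⟨ ℕ/1-homo-+ (x ℕ.+ y) z ⟨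
    + (x ℕ.+ y ℕ.+ z) / 1             ∎
    where
    x y z : ℕ
    x = 2 ℕ.* (∣ b ∣ ℕ.* ∣ b ∣)
    y = 5 ℕ.* (∣ c ∣ ℕ.* ∣ c ∣)
    z = 10 ℕ.* (∣ d ∣ ℕ.* ∣ d ∣)

  inverse-square-cancel : ∀ x q {y} → x * q ≡ 1ℚ → q * q * y ≡ 1ℚ → y ≡ x * x
  inverse-square-cancel x q {y} xq≡1 qqy≡1 = begin
    y                     ≡⟨ *-identityˡ y ⟨
    1ℚ * y                ≡⟨ cong (_* y) (cong₂ _*_ xq≡1 xq≡1) ⟨
    (x * q) * (x * q) * y ≡⟨ solve 3 (λ x q y → (x :* q) :* (x :* q) :* y := x :* x :* (q :* q :* y)) refl x q y ⟩
    x * x * (q * q * y)   ≡⟨ cong (x * x *_) qqy≡1 ⟩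
    x * x * 1ℚ            ≡⟨ *-identityʳ (x * x) ⟩
    x * x                 ∎
    where open +-*-Solver using (solve; _:*_; _:=_)

  -- K with solver expressions as coefficients. Its operations copy those of K,
  -- so evaluating a Kˢ-expression yields the corresponding element of K on the nose.
  record Kˢ (n : ℕ) : Set where
    constructor mkKˢ
    field
      r s t u : +-*-Solver.Polynomial n

  module _ {n : ℕ} where
    open +-*-Solver using (Polynomial; con; _:+_; _:*_)

    infixl 6 _+Kˢ_
    infixl 7 _*Kˢ_

    _+Kˢ_ _*Kˢ_ : Kˢ n → Kˢ n → Kˢ n
    mkKˢ a b c d +Kˢ mkKˢ a' b' c' d' = mkKˢ (a :+ a') (b :+ b') (c :+ c') (d :+ d')
    mkKˢ a b c d *Kˢ mkKˢ a' b' c' d' = mkKˢ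
      (a :* a' :+ con (+ 2 / 1) :* (b :* b') :+ con (+ 5 / 1) :* (c :* c') :+ con (+ 10 / 1) :* (d :* d'))
      (a :* b' :+ b :* a' :+ con (+ 5 / 1) :* (c :* d' :+ d :* c'))
      (a :* c' :+ c :* a' :+ con (+ 2 / 1) :* (b :* d' :+ d :* b'))
      (a :* d' :+ d :* a' :+ b :* c' :+ c :* b')

    ℚ→Kˢ : Polynomial n → Kˢ n
    ℚ→Kˢ x = mkKˢ x (con 0ℚ) (con 0ℚ) (con 0ℚ)

    constKˢ : ℚ → ℚ → ℚ → ℚ → Kˢ n
    constKˢ a b c d = mkKˢ (con a) (con b) (con c) (con d)

    Nˢ : Kˢ n → Kˢ n → Kˢ n → Kˢ n → Kˢ n
    Nˢ a b c d = a *Kˢ a +Kˢ b *Kˢ b +Kˢ c *Kˢ c +Kˢ d *Kˢ d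

  real-part-of-norm : ∀ q x y z →
    K.r (N (ℚ→K q ·H quat 0K (ℚ→K x *K √2) (ℚ→K y *K √5) (ℚ→K z *K √10))) ≡ q * q * formℚ x y z
  real-part-of-norm = solve 4 (λ q x y z →
    Kˢ.r (Nˢ (ℚ→Kˢ q *Kˢ constKˢ 0ℚ 0ℚ 0ℚ 0ℚ)
             (ℚ→Kˢ q *Kˢ (ℚ→Kˢ x *Kˢ constKˢ 0ℚ 1ℚ 0ℚ 0ℚ))
             (ℚ→Kˢ q *Kˢ (ℚ→Kˢ y *Kˢ constKˢ 0ℚ 0ℚ 1ℚ 0ℚ))
             (ℚ→Kˢ q *Kˢ (ℚ→Kˢ z *Kˢ constKˢ 0ℚ 0ℚ 0ℚ 1ℚ)))
    := q :* q :* (con (+ 2 / 1) :* (x :* x) :+ con (+ 5 / 1) :* (y :* y) :+ con (+ 10 / 1) :* (z :* z))) refl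
    where open +-*-Solver using (solve; con; _:+_; _:*_; _:=_)

  norm≡1⇒square-represented : ∀ b c d e (e≢0 : e ≢ 0ℤ) →
    N (ℚ→K (inv e e≢0) ·H quat 0K (ℤ→K b *K √2) (ℤ→K c *K √5) (ℤ→K d *K √10)) ≡ 1K →
    SquareRepresented ∣ e ∣
  norm≡1⇒square-represented b c d e e≢0 norm≡1 =
    ∣ b ∣ , ∣ c ∣ , ∣ d ∣ , ℤ.+-injective (/1-injective (begin
      + form (∣ b ∣) (∣ c ∣) (∣ d ∣) / 1 ≡⟨ formℚ-/1 b c d ⟨
      formℚ (b / 1) (c / 1) (d / 1)      ≡⟨ inverse-square-cancel (e / 1) q (i/1*inv≡1 e e≢0) q²form≡1 ⟩
      (e / 1) * (e / 1)                  ≡⟨ i/1²≡+∣i∣²/1 e ⟩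
      + (∣ e ∣ ℕ.* ∣ e ∣) / 1            ∎))
    where
    q : ℚ
    q = inv e e≢0

    q²form≡1 : q * q * formℚ (b / 1) (c / 1) (d / 1) ≡ 1ℚ
    q²form≡1 = trans (sym (real-part-of-norm q (b / 1) (c / 1) (d / 1))) (cong K.r norm≡1)

theorem34 : ¬ (Σ[ b ∈ ℤ ] Σ[ c ∈ ℤ ] Σ[ d ∈ ℤ ] Σ[ e ∈ ℤ ] Σ[ e≢0 ∈ e ≢ 0ℤ ]
                 N (ℚ→K (inv e e≢0) ·H quat 0K (ℤ→K b *K √2) (ℤ→K c *K √5) (ℤ→K d *K √10)) ≡ 1K)
theorem34 (b , c , d , e , e≢0 , norm≡1) =
  e≢0 (∣i∣≡0⇒i≡0 (square-represented⇒≡0 (<-wellFounded _)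
                    (norm≡1⇒square-represented b c d e e≢0 norm≡1)))
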